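{- Let $\mathcal L$ be a combined LTSI satisfying WF and the Parabolic Lemma (PL). Then for every process $P$ there is a unique irreversible process $I$ such that there is a path from $I$ to $P$.
   Context: Setting. $\mathrm{Lab}$ is a set of labels and $\overline{\mathrm{Lab}}=\{\overline a: a\in\mathrm{Lab}\}$ a disjoint copy (reverse labels), with $\overline{\overline a}=a$. A combined LTSI $(\mathrm{Proc},\mathrm{Lab},\to,\iota)$ consists of a set $\mathrm{Proc}$ of processes, a set of forward transitions $(P,a,Q)$ with $a\in\mathrm{Lab}$, the set $\to$ of all transitions, consisting of the forward transitions together with, for each forward transition $(P,a,Q)$, the backward transition $(Q,\overline a,P)$, and an irreflexive symmetric relation $\iota$ (independence) on transitions. Write $t:P\xrightarrow{\alpha}Q$ for $t=(P,\alpha,Q)$ and $\overline t=(Q,\overline\alpha,P)$. A path is a finite (possibly empty) sequence of consecutive transitions (forward or backward); $|r|$ is its length, $rs$ concatenation, $\overline r$ the inverse path. A path is forward-only if it contains no backward transitions. A process is irreversible if it is the source of no backward transition. WF: there is no infinite sequence of processes $P_0,P_1,\dots$ (not necessarily distinct) with forward transitions $P_{i+1}\xrightarrow{a_i}P_i$ for all $i\ge 0$. Causal equivalence $\approx$ is the smallest equivalence relation on paths closed under composition and satisfying: (swap) if $t:P\xrightarrow{\alpha}Q$, $u:P\xrightarrow{\beta}R$ with $t\,\iota\,u$ and $u':Q\xrightarrow{\beta}S$, $t':R\xrightarrow{\alpha}S$, then $tu'\approx ut'$; (cancellation) $t\overline t\approx\varepsilon$ and $\overline t t\approx\varepsilon$.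 PL (Parabolic Lemma): for every path $r$ there are forward-only paths $s,s'$ with $r\approx\overline s\,s'$ and $|s|+|s'|\le|r|$. -}

module Defs where

open import Level using (0ℓ)
open import Data.Nat using (ℕ; zero; suc; _+_; _≤_)
open import Data.Product using (Σ; _×_; _,_)
open import Data.Sum using (_⊎_; inj₁; inj₂)
open import Data.Empty using (⊥)
open import Data.Unit using (⊤)
open import Relation.Nullary using (¬_)
open import Relation.Binary.PropositionalEquality using (_≡_)

-- Labels of transitions: inj₁ a is the forward label a, inj₂ a is the reverse label ā.
bar : {L : Set} → L ⊎ L → L ⊎ L
bar (inj₁ a) = inj₂ a
bar (inj₂ a) = inj₁ a

-- The forward transitions form a *set* of triples, so the
-- relation Fwd is required to be proof-irrelevant.  The independence relation
-- is an irreflexive symmetric relation on triples (P , α , Q) (it is only ever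
-- consulted on actual transitions).
record LTSI : Set₁ where
  field
    Proc     : Set
    Lab      : Set
    Fwd      : Proc → Lab → Proc → Set
    Fwd-prop : ∀ {P a Q} (x y : Fwd P a Q) → x ≡ y
    ι        : Proc × (Lab ⊎ Lab) × Proc → Proc × (Lab ⊎ Lab) × Proc → Set
    ι-irrefl : ∀ t → ¬ ι t t
    ι-sym    : ∀ {t u} → ι t u → ι u t

module _ (L : LTSI) where
  open LTSI L

  IsTr : Proc → Lab ⊎ Lab → Proc → Set
  IsTr P (inj₁ a) Q = Fwd P a Q
  IsTr P (inj₂ a) Q = Fwd Q a P

  invTr : ∀ {P Q} α → IsTr P α Q → IsTr Q (bar α) P
  invTr (inj₁ a) t = t
  invTr (inj₂ a) t = t

  data Path : Proc → Proc → Set where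
    []   : ∀ {P} → Path P P
    step : ∀ {P R Q} (α : Lab ⊎ Lab) → IsTr P α R → Path R Q → Path P Q

  _++_ : ∀ {P Q R} → Path P Q → Path Q R → Path P R
  [] ++ s = s
  step α t r ++ s = step α t (r ++ s)

  len : ∀ {P Q} → Path P Q → ℕ
  len [] = zero
  len (step _ _ r) = suc (len r)

  rev : ∀ {P Q} → Path P Q → Path Q P
  rev [] = []
  rev (step α t r) = rev r ++ step (bar α) (invTr α t) []

  ForwardOnly : ∀ {P Q} → Path P Q → Set
  ForwardOnly [] = ⊤
  ForwardOnly (step (inj₁ a) _ r) = ForwardOnly r
  ForwardOnly (step (inj₂ a) _ r) = ⊥

  infix 4 _≈_
  data _≈_ : ∀ {P Q} → Path P Q → Path P Q → Set where
    ≈-refl  : ∀ {P Q} {r : Path P Q} → r ≈ r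
    ≈-sym   : ∀ {P Q} {r s : Path P Q} → r ≈ s → s ≈ r
    ≈-trans : ∀ {P Q} {r s u : Path P Q} → r ≈ s → s ≈ u → r ≈ u
    ≈-comp  : ∀ {P Q R} {r r' : Path P Q} {s s' : Path Q R} →
              r ≈ r' → s ≈ s' → (r ++ s) ≈ (r' ++ s')
    swap    : ∀ {P Q R S} (α β : Lab ⊎ Lab)
              (t : IsTr P α Q) (u : IsTr P β R) →
              ι (P , α , Q) (P , β , R) →
              (u' : IsTr Q β S) (t' : IsTr R α S) →
              step α t (step β u' []) ≈ step β u (step α t' [])
    cancel₁ : ∀ {P Q} (α : Lab ⊎ Lab) (t : IsTr P α Q) →
              step α t (step (bar α) (invTr α t) []) ≈ []
    cancel₂ : ∀ {P Q} (α : Lab ⊎ Lab) (t : IsTr P α Q) →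
              step (bar α) (invTr α t) (step α t []) ≈ []

  WF : Set
  WF = ¬ (Σ (ℕ → Proc) λ f → ∀ i → Σ Lab λ a → Fwd (f (suc i)) a (f i))

  PL : Set
  PL = ∀ {P Q} (r : Path P Q) →
       Σ Proc λ R → Σ (Path R P) λ s → Σ (Path R Q) λ s' →
         ForwardOnly s × ForwardOnly s' × (r ≈ (rev s ++ s')) ×
         (len s + len s' ≤ len r)

  Irreversible : Proc → Set
  Irreversible I = ∀ (a : Lab) (Q : Proc) → ¬ IsTr I (inj₂ a) Q

-- Existence: if P had no irreversible origin, excluded middle would give it a
-- forward predecessor, again without one (an irreversible origin of the
-- predecessor would be one of P); iterating yields the infinite backward chain
-- that WF forbids.
-- Uniqueness: for irreversible I, J with paths to P, PL rewrites the path from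
-- J to I through P as s̄ s' with s, s' forward-only, and a forward-only path
-- can only end in an irreversible process if it is empty; so J = I.
module Submission where

open import Defs
open import Level using (0ℓ)
open import Axiom.ExcludedMiddle using (ExcludedMiddle)
open import Data.Product using (Σ; _×_; _,_; proj₁)
open import Data.Sum using (inj₁; inj₂)
open import Data.Nat using (ℕ; suc)
open import Data.Nat.GeneralisedArithmetic using (fold)
open import Function using (_∘_)
open import Data.Empty using (⊥-elim)
open import Relation.Nullary using (¬_; yes; no)
open import Relation.Binary.PropositionalEquality using (_≡_; refl; sym; trans)

module _ (L : LTSI) where
  open LTSI L

  HasIrreversibleOrigin : Proc → Set
  HasIrreversibleOrigin P = Σ Proc λ I → Irreversible L I × Path L I P

  WF⇒¬predecessorClosed : WF L → (S : Proc → Set) →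
    (∀ X → S X → Σ Proc λ Y → Σ Lab λ a → Fwd Y a X × S Y) →
    ∀ P → ¬ S P
  WF⇒¬predecessorClosed wf S pred P SP = wf (proj₁ ∘ chain , descends)
    where
    predecessor : Σ Proc S → Σ Proc S
    predecessor (X , SX) with pred X SX
    ... | Y , _ , _ , SY = Y , SY

    chain : ℕ → Σ Proc S
    chain = fold (P , SP) predecessor

    descends : ∀ i → Σ Lab λ a → Fwd (proj₁ (chain (suc i))) a (proj₁ (chain i))
    descends i with chain i
    ... | X , SX with pred X SX
    ...   | _ , a , t , _ = a , t

  forwardOnly-to-irreversible-is-trivial : ∀ {R X} (s : Path L R X) →
    ForwardOnly L s → Irreversible L X → R ≡ X
  forwardOnly-to-irreversible-is-trivial [] _ _ = refl
  forwardOnly-to-irreversible-is-trivial (step (inj₁ a) t r) fo irr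
    with forwardOnly-to-irreversible-is-trivial r fo irr
  ... | refl = ⊥-elim (irr a _ t)
  forwardOnly-to-irreversible-is-trivial (step (inj₂ a) t r) () irr

  irreversibleOrigin-unique : PL L → ∀ {P I J} →
    Irreversible L I → Path L I P → Irreversible L J → Path L J P → J ≡ I
  irreversibleOrigin-unique pl irrI p irrJ q with pl (_++_ L q (rev L p))
  ... | _ , s , s' , fo , fo' , _ =
    trans (sym (forwardOnly-to-irreversible-is-trivial s fo irrJ))
          (forwardOnly-to-irreversible-is-trivial s' fo' irrI)

  module _ (em : ExcludedMiddle 0ℓ) where

    noOrigin⇒predecessorWithoutOrigin : ∀ X → ¬ HasIrreversibleOrigin X →
      Σ Proc λ Y → Σ Lab λ a → Fwd Y a X × ¬ HasIrreversibleOrigin Y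
    noOrigin⇒predecessorWithoutOrigin X noOrigin
      with em {Σ Lab λ a → Σ Proc λ Y → Fwd Y a X}
    ... | yes (a , Y , t) =
      Y , a , t , λ (I , irr , p) → noOrigin (I , irr , _++_ L p (step (inj₁ a) t []))
    ... | no noPredecessor =
      ⊥-elim (noOrigin (X , (λ a Y t → noPredecessor (a , Y , t)) , []))

    irreversibleOrigin : WF L → ∀ P → HasIrreversibleOrigin P
    irreversibleOrigin wf P with em {HasIrreversibleOrigin P}
    ... | yes origin = origin
    ... | no noOrigin =
      ⊥-elim (WF⇒¬predecessorClosed wf (λ X → ¬ HasIrreversibleOrigin X)
                noOrigin⇒predecessorWithoutOrigin P noOrigin)

proposition3p6 : ExcludedMiddle 0ℓ → (L : LTSI) → WF L → PL L →
    (P : LTSI.Proc L) →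
    Σ (LTSI.Proc L) λ I → Irreversible L I × Path L I P ×
    ((J : LTSI.Proc L) → Irreversible L J → Path L J P → J ≡ I)
proposition3p6 em L wf pl P with irreversibleOrigin L em wf P
... | I , irr , p = I , irr , p , λ J irrJ q → irreversibleOrigin-unique L pl irr p irrJ q
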